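{- Let $0\le k\le n$ be integers and $m=\min(k,n-k)$. Then \[P(n,k)\le 2^{n-2}\left(\left(k-\frac m2-\frac74\right)^2+\frac{9k}{2}+\frac{79}{16}\right)+2^k\left(\frac32\right)^m\left(\frac k2-\frac m6\right)-2^k(k+1)-2^{n-k}\left(\frac32\right)^m.\]
   Context: For a power of two $M$ let $O(M)=\frac M4(\log_2^2M-\log_2M+4)-1$ (the size of Batcher's odd-even sorting network on $M$ inputs). For powers of two $1\le K\le N$ define $H(N,K)$, the number of comparators of the improved pairwise selection network $pw\_hbit\_sel^N_K$, by $H(N,1)=N-1$; $H(N,N)=O(N)$ for $N>1$; and $H(N,K)=H(N/2,K)+H(N/2,K/2)+\frac N2+\frac{K\log_2K}{2}$ for $1<K<N$. Set $P(n,k)=H(2^n,2^k)$. -}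

module Defs where

open import Data.Nat as ℕ using (ℕ; zero; suc; _∸_; _⊓_)
open import Data.Nat.DivMod using (_/_)
open import Data.Integer using (+_)
open import Data.Rational as ℚ using (ℚ; 1ℚ)
open import Relation.Nullary using (yes; no)

-- Batcher's odd-even sorting network size, O(2^n) = 2^n/4 (n^2 - n + 4) - 1
-- (the division by 4 is exact for every n).
Obatcher : ℕ → ℕ
Obatcher n = ((2 ℕ.^ n) ℕ.* (n ℕ.* n ∸ n ℕ.+ 4)) / 4 ∸ 1

-- P n k = H(2^n, 2^k), defined for k ≤ n (values for k > n are junk).
--   H(N,1) = N - 1                      ~  P n 0 = 2^n - 1
--   H(N,N) = O(N), N > 1                ~  P (n+1) (n+1) = O(2^(n+1))
--   H(N,K) = H(N/2,K) + H(N/2,K/2) + N/2 + (K log K)/2, 1<K<N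
--                                       ~  P (n+1) (k+1) = P n (k+1) + P n k + 2^n + (k+1) 2^(k+1) / 2
P : ℕ → ℕ → ℕ
P n zero = 2 ℕ.^ n ∸ 1
P zero (suc k) = 0
P (suc n) (suc k) with k ℕ.≟ n
... | yes _ = Obatcher (suc n)
... | no _ = P n (suc k) ℕ.+ P n k ℕ.+ 2 ℕ.^ n ℕ.+ (suc k ℕ.* 2 ℕ.^ suc k) / 2

ℕ→ℚ : ℕ → ℚ
ℕ→ℚ a = + a ℚ./ 1

_^ℚ_ : ℚ → ℕ → ℚ
q ^ℚ zero = 1ℚ
q ^ℚ suc m = q ℚ.* (q ^ℚ m)

-- the right-hand side of the bound, with m = min(k, n-k); 2^(n-2) is written 2^n * (1/4)
-- so that it is the true rational value also for n < 2
bound : ℕ → ℕ → ℚ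
bound n k =
  let m = k ⊓ (n ∸ k)
      K = ℕ→ℚ k
      M = ℕ→ℚ m
  in ℕ→ℚ (2 ℕ.^ n) ℚ.* (+ 1 ℚ./ 4) ℚ.*
       ((K ℚ.- M ℚ.* (+ 1 ℚ./ 2) ℚ.- (+ 7 ℚ./ 4)) ^ℚ 2
        ℚ.+ (+ 9 ℚ./ 2) ℚ.* K ℚ.+ (+ 79 ℚ./ 16))
     ℚ.+ ℕ→ℚ (2 ℕ.^ k) ℚ.* ((+ 3 ℚ./ 2) ^ℚ m) ℚ.* (K ℚ.* (+ 1 ℚ./ 2) ℚ.- M ℚ.* (+ 1 ℚ./ 6))
     ℚ.- ℕ→ℚ (2 ℕ.^ k) ℚ.* (K ℚ.+ 1ℚ)
     ℚ.- ℕ→ℚ (2 ℕ.^ (n ∸ k)) ℚ.* ((+ 3 ℚ./ 2) ^ℚ m)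

module Submission where

-- The bound equals 2^n - 1 at k = 0 and 2^n (n^2 - n + 4)/4 - 1 >= O(2^n) at
-- k = n, so by induction it suffices that it is a supersolution of the recurrence. Writing
-- n = k + 1 + j, the min in the bound resolves differently for k < j, k = j and j < k; in each
-- regime the excess of bound(n+1,k+1) over the right-hand side of the recurrence is 0 (k = j) or a
-- positive multiple of a polynomial difference in k, j, 2^k, 2^j, 3^min(k,j) that is nonnegative
-- because 3^i <= 4^i.

open import Defs
open import Data.Nat using (ℕ; _≤_)
open import Data.Rational using () renaming (_≤_ to _≤ℚ_)

open import Data.Nat as ℕ using (zero; suc; _∸_; _⊓_; _<_; s≤s; z≤n)
import Data.Nat.Properties as ℕₚ
open import Data.Integer as ℤ using (+_)
import Data.Integer.Properties as ℤₚ
open import Data.Rational as ℚ using (ℚ; 0ℚ; 1ℚ; toℚᵘ)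
import Data.Rational.Properties as ℚₚ
open import Data.Rational.Unnormalised as ℚᵘ using (mkℚᵘ; *≡*; *≤*)
import Data.Rational.Unnormalised.Properties as ℚᵘₚ
import Data.Nat.Coprimality as Coprime
open import Data.List using (_∷_; [])
open import Data.Sum using (inj₁; inj₂)
open import Level using (0ℓ)
open import Relation.Binary.PropositionalEquality
open import Relation.Nullary using (yes; no; contradiction)
open import Relation.Nullary.Decidable using (dec⇒maybe)
import Tactic.RingSolver as RingSolver
import Tactic.RingSolver.Core.AlmostCommutativeRing as ACR

-- Natural-number arithmetic, scoped so that its operators do not clash with those of ℚ below.
module _ where
  open import Data.Nat using (_+_; _*_; _^_)
  open import Data.Nat.DivMod using (_/_; m*n/n≡m; m/n*n≤m; m≥n⇒m/n>0)
  open import Data.Nat.Tactic.RingSolver using (solve-∀; solve)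

  ≤-by-excess : ∀ {m n} w → m + w ≡ n → m ≤ n
  ≤-by-excess {m} w refl = ℕₚ.m≤m+n m w

  with-excess : ∀ {s Z} (Goal : ℕ → Set) → s ≤ Z → (∀ g → Goal (s + g)) → Goal Z
  with-excess {s} {Z} Goal s≤Z h = subst Goal (ℕₚ.m+[n∸m]≡n s≤Z) (h (Z ∸ s))

  3^n≤2^n*2^n : ∀ n → 3 ^ n ≤ 2 ^ n * 2 ^ n
  3^n≤2^n*2^n zero    = ℕₚ.≤-refl
  3^n≤2^n*2^n (suc n) =
    ℕₚ.≤-trans (ℕₚ.*-mono-≤ (ℕₚ.n≤1+n 3) (3^n≤2^n*2^n n)) (ℕₚ.≤-reflexive (4x²≡[2x]² (2 ^ n)))
    where
    4x²≡[2x]² : ∀ x → 4 * (x * x) ≡ 2 * x * (2 * x)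
    4x²≡[2x]² = solve-∀

  -- The slack of the recurrence is 1/12 (if k < j), resp. 1/36 (if j < k), times the difference of
  -- the two sides, with s = 3^i, Z = 4^i, q = 2^d for i = min(k, j) and d = |k - j| - 1
  -- (see recurrence-k<j and recurrence-j<k).
  Slack-k<j : ℕ → ℕ → ℕ → ℕ → Set
  Slack-k<j k s Z q = 4 * k * s + 12 * Z * q ≤ 6 * Z * q * k + 12 * s * q

  Slack-j<k : ℕ → ℕ → ℕ → ℕ → ℕ → Set
  Slack-j<k j d s Z q = 36 * Z * q + s * q * (12 * j + 18 * d) ≤ 18 * Z * q * (j + 2 * d) + 36 * s

  slack-k<j : ∀ k {q} → 1 ≤ q → Slack-k<j k (3 ^ k) (2 ^ k * 2 ^ k) q
  slack-k<j 0 {suc q} _ = ℕₚ.≤-reflexive (solve (q ∷ []))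
  slack-k<j 1 {suc q} _ = ≤-by-excess (12 * q) (solve (q ∷ []))
  slack-k<j k@(suc (suc e)) {suc q} _ =
    with-excess (λ Z → Slack-k<j k (3 ^ k) Z (suc q)) (3^n≤2^n*2^n k) (gap (3 ^ k))
    where
    gap : ∀ s g → Slack-k<j (2 + e) s (s + g) (suc q)
    gap s g = ≤-by-excess (4 * s + 12 * s * q + 2 * s * e + 6 * s * e * q + 6 * g * (1 + q) * e)
                          (solve (e ∷ q ∷ s ∷ g ∷ []))

  slack-j<k : ∀ j d → Slack-j<k j d (3 ^ j) (2 ^ j * 2 ^ j) (2 ^ d)
  slack-j<k 0 0 = ℕₚ.≤-refl
  slack-j<k 1 0 = ℕₚ.≤-refl
  slack-j<k j@(suc (suc e)) 0 =
    with-excess (λ Z → Slack-j<k j 0 (3 ^ j) Z 1) (3^n≤2^n*2^n j) (gap (3 ^ j))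
    where
    gap : ∀ s g → Slack-j<k (2 + e) 0 s (s + g) 1
    gap s g = ≤-by-excess (12 * s + 6 * s * e + 18 * g * e) (solve (e ∷ s ∷ g ∷ []))
  slack-j<k j 1 =
    with-excess (λ Z → Slack-j<k j 1 (3 ^ j) Z 2) (3^n≤2^n*2^n j) (gap (3 ^ j))
    where
    gap : ∀ s g → Slack-j<k j 1 s (s + g) 2
    gap s g = ≤-by-excess (12 * s * j + 36 * g * j) (solve (j ∷ s ∷ g ∷ []))
  slack-j<k j (suc (suc d)) =
    with-excess (λ Z → Slack-j<k j (2 + d) (3 ^ j) Z (2 ^ (2 + d))) (3^n≤2^n*2^n j)
                (λ g → gap (3 ^ j) g (2 ^ (2 + d)))
    where
    gap : ∀ s g q → Slack-j<k j (2 + d) s (s + g) q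
    gap s g q = ≤-by-excess (6 * s * q * j + 18 * s * q * d + 18 * g * q * j
                               + 36 * g * q + 36 * g * q * d + 36 * s)
                            (solve (j ∷ d ∷ s ∷ g ∷ q ∷ []))

  4*[a/4∸1]+4≤a : ∀ {a} → 4 ≤ a → 4 * (a / 4 ∸ 1) + 4 ≤ a
  4*[a/4∸1]+4≤a {a} 4≤a = ℕₚ.≤-trans (ℕₚ.≤-reflexive (times-4 (a / 4) (m≥n⇒m/n>0 4≤a))) (m/n*n≤m a 4)
    where
    4q+4≡[1+q]4 : ∀ q → 4 * q + 4 ≡ suc q * 4
    4q+4≡[1+q]4 = solve-∀
    times-4 : ∀ q → 1 ≤ q → 4 * (q ∸ 1) + 4 ≡ q * 4
    times-4 (suc q) _ = 4q+4≡[1+q]4 q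

  P-diagonal : ∀ n → P (suc n) (suc n) ≡ Obatcher (suc n)
  P-diagonal n with n ℕ.≟ n
  ... | yes _  = refl
  ... | no n≢n = contradiction refl n≢n

  P-recurrence : ∀ {n k} → k < n → P (suc n) (suc k) ≡ P n (suc k) + P n k + 2 ^ n + suc k * 2 ^ k
  P-recurrence {n} {k} k<n with k ℕ.≟ n
  ... | yes refl = contradiction k<n (ℕₚ.<-irrefl refl)
  ... | no _     = cong (λ t → P n (suc k) + P n k + 2 ^ n + t) halve
    where
    reassociate : ∀ x y → x * (2 * y) ≡ x * y * 2
    reassociate = solve-∀
    halve : suc k * 2 ^ suc k / 2 ≡ suc k * 2 ^ k
    halve = trans (cong (_/ 2) (reassociate (suc k) (2 ^ k))) (m*n/n≡m (suc k * 2 ^ k) 2)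

open import Data.Rational using (_+_; _*_; _-_; _/_)
open import Data.Rational.Solver using (module +-*-Solver)
open +-*-Solver using (Polynomial; solve; _:=_; con; _:+_; _:*_; _:-_)

ℚ-ring : ACR.AlmostCommutativeRing 0ℓ 0ℓ
ℚ-ring = ACR.fromCommutativeRing ℚₚ.+-*-commutativeRing λ q → dec⇒maybe (0ℚ ℚ.≟ q)

p+q-q≡p : ∀ p q → p + q - q ≡ p
p+q-q≡p = RingSolver.solve-∀ ℚ-ring

toℚᵘ-ℕ→ℚ : ∀ a → toℚᵘ (ℕ→ℚ a) ≡ mkℚᵘ (+ a) 0
toℚᵘ-ℕ→ℚ a = cong toℚᵘ (ℚₚ.normalize-coprime (Coprime.sym (Coprime.1-coprimeTo a)))

ℕ→ℚ-+ : ∀ a b → ℕ→ℚ (a ℕ.+ b) ≡ ℕ→ℚ a + ℕ→ℚ b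
ℕ→ℚ-+ a b = ℚₚ.toℚᵘ-injective (begin-equality
  toℚᵘ (ℕ→ℚ (a ℕ.+ b))                 ≡⟨ toℚᵘ-ℕ→ℚ (a ℕ.+ b) ⟩
  mkℚᵘ (+ (a ℕ.+ b)) 0                 ≃⟨ *≡* (cong (ℤ._* + 1) numerators) ⟩
  mkℚᵘ (+ a) 0 ℚᵘ.+ mkℚᵘ (+ b) 0       ≡⟨ cong₂ ℚᵘ._+_ (toℚᵘ-ℕ→ℚ a) (toℚᵘ-ℕ→ℚ b) ⟨
  toℚᵘ (ℕ→ℚ a) ℚᵘ.+ toℚᵘ (ℕ→ℚ b)       ≃⟨ ℚₚ.toℚᵘ-homo-+ (ℕ→ℚ a) (ℕ→ℚ b) ⟨
  toℚᵘ (ℕ→ℚ a + ℕ→ℚ b)                 ∎)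
  where
  open ℚᵘₚ.≤-Reasoning
  numerators : + (a ℕ.+ b) ≡ + a ℤ.* + 1 ℤ.+ + b ℤ.* + 1
  numerators = sym (cong₂ ℤ._+_ (ℤₚ.*-identityʳ (+ a)) (ℤₚ.*-identityʳ (+ b)))

ℕ→ℚ-* : ∀ a b → ℕ→ℚ (a ℕ.* b) ≡ ℕ→ℚ a * ℕ→ℚ b
ℕ→ℚ-* a b = ℚₚ.toℚᵘ-injective (begin-equality
  toℚᵘ (ℕ→ℚ (a ℕ.* b))                 ≡⟨ toℚᵘ-ℕ→ℚ (a ℕ.* b) ⟩
  mkℚᵘ (+ (a ℕ.* b)) 0                 ≃⟨ *≡* (cong (ℤ._* + 1) (ℤₚ.pos-* a b)) ⟩
  mkℚᵘ (+ a) 0 ℚᵘ.* mkℚᵘ (+ b) 0       ≡⟨ cong₂ ℚᵘ._*_ (toℚᵘ-ℕ→ℚ a) (toℚᵘ-ℕ→ℚ b) ⟨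
  toℚᵘ (ℕ→ℚ a) ℚᵘ.* toℚᵘ (ℕ→ℚ b)       ≃⟨ ℚₚ.toℚᵘ-homo-* (ℕ→ℚ a) (ℕ→ℚ b) ⟨
  toℚᵘ (ℕ→ℚ a * ℕ→ℚ b)                 ∎)
  where open ℚᵘₚ.≤-Reasoning

ℕ→ℚ-mono-≤ : ∀ {a b} → a ≤ b → ℕ→ℚ a ℚ.≤ ℕ→ℚ b
ℕ→ℚ-mono-≤ {a} {b} a≤b = ℚₚ.toℚᵘ-cancel-≤
  (subst₂ ℚᵘ._≤_ (sym (toℚᵘ-ℕ→ℚ a)) (sym (toℚᵘ-ℕ→ℚ b)) (*≤* (ℤₚ.*-monoʳ-≤-nonNeg (+ 1) (ℤ.+≤+ a≤b))))

ℕ→ℚ-∸ : ∀ {a b} → b ≤ a → ℕ→ℚ (a ∸ b) ≡ ℕ→ℚ a - ℕ→ℚ b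
ℕ→ℚ-∸ {a} {b} b≤a = begin
  ℕ→ℚ (a ∸ b)                    ≡⟨ p+q-q≡p (ℕ→ℚ (a ∸ b)) (ℕ→ℚ b) ⟨
  ℕ→ℚ (a ∸ b) + ℕ→ℚ b - ℕ→ℚ b    ≡⟨ cong (_- ℕ→ℚ b) (ℕ→ℚ-+ (a ∸ b) b) ⟨
  ℕ→ℚ (a ∸ b ℕ.+ b) - ℕ→ℚ b      ≡⟨ cong (λ c → ℕ→ℚ c - ℕ→ℚ b) (ℕₚ.m∸n+n≡m b≤a) ⟩
  ℕ→ℚ a - ℕ→ℚ b                  ∎
  where open ≡-Reasoning

ℕ→ℚ-suc : ∀ a → ℕ→ℚ (suc a) ≡ 1ℚ + ℕ→ℚ a
ℕ→ℚ-suc = ℕ→ℚ-+ 1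

two : ℚ
two = ℕ→ℚ 2

ℕ→ℚ-2^suc : ∀ a → ℕ→ℚ (2 ℕ.^ suc a) ≡ two * ℕ→ℚ (2 ℕ.^ a)
ℕ→ℚ-2^suc a = ℕ→ℚ-* 2 (2 ℕ.^ a)

ℕ→ℚ-2^+ : ∀ a b → ℕ→ℚ (2 ℕ.^ (a ℕ.+ b)) ≡ ℕ→ℚ (2 ℕ.^ a) * ℕ→ℚ (2 ℕ.^ b)
ℕ→ℚ-2^+ a b = trans (cong ℕ→ℚ (ℕₚ.^-distribˡ-+-* 2 a b)) (ℕ→ℚ-* (2 ℕ.^ a) (2 ℕ.^ b))

infixl 6 _⊕_
infixl 7 _⊗_

data Expr : Set where
  lit : ℕ → Expr
  _⊕_ _⊗_ : Expr → Expr → Expr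

⟦_⟧ℕ : Expr → ℕ
⟦ lit a ⟧ℕ = a
⟦ e ⊕ f ⟧ℕ = ⟦ e ⟧ℕ ℕ.+ ⟦ f ⟧ℕ
⟦ e ⊗ f ⟧ℕ = ⟦ e ⟧ℕ ℕ.* ⟦ f ⟧ℕ

⟦_⟧ℚ : Expr → ℚ
⟦ lit a ⟧ℚ = ℕ→ℚ a
⟦ e ⊕ f ⟧ℚ = ⟦ e ⟧ℚ + ⟦ f ⟧ℚ
⟦ e ⊗ f ⟧ℚ = ⟦ e ⟧ℚ * ⟦ f ⟧ℚ

ℕ→ℚ-⟦⟧ : ∀ e → ℕ→ℚ ⟦ e ⟧ℕ ≡ ⟦ e ⟧ℚ
ℕ→ℚ-⟦⟧ (lit a) = refl
ℕ→ℚ-⟦⟧ (e ⊕ f) = trans (ℕ→ℚ-+ ⟦ e ⟧ℕ ⟦ f ⟧ℕ) (cong₂ _+_ (ℕ→ℚ-⟦⟧ e) (ℕ→ℚ-⟦⟧ f))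
ℕ→ℚ-⟦⟧ (e ⊗ f) = trans (ℕ→ℚ-* ⟦ e ⟧ℕ ⟦ f ⟧ℕ) (cong₂ _*_ (ℕ→ℚ-⟦⟧ e) (ℕ→ℚ-⟦⟧ f))

⟦⟧-mono-≤ : ∀ e f → ⟦ e ⟧ℕ ≤ ⟦ f ⟧ℕ → ⟦ e ⟧ℚ ℚ.≤ ⟦ f ⟧ℚ
⟦⟧-mono-≤ e f e≤f = subst₂ ℚ._≤_ (ℕ→ℚ-⟦⟧ e) (ℕ→ℚ-⟦⟧ f) (ℕ→ℚ-mono-≤ e≤f)

≤-by-gap : ∀ {x y c r l} → .{{ℚ.NonNegative c}} → r ℚ.≤ l → y + c * r ≡ x + c * l → x ℚ.≤ y
≤-by-gap {x} {y} {c} {r} {l} r≤l gap = begin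
  x                  ≡⟨ p+q-q≡p x (c * r) ⟨
  x + c * r - c * r  ≤⟨ ℚₚ.+-monoˡ-≤ (ℚ.- (c * r)) (ℚₚ.+-monoʳ-≤ x (ℚₚ.*-monoˡ-≤-nonNeg c r≤l)) ⟩
  x + c * l - c * r  ≡⟨ cong (_- c * r) gap ⟨
  y + c * r - c * r  ≡⟨ p+q-q≡p y (c * r) ⟩
  y                  ∎
  where open ℚₚ.≤-Reasoning

3/2 : ℚ
3/2 = + 3 / 2

2^n*[3/2]^n≡3^n : ∀ n → ℕ→ℚ (2 ℕ.^ n) * (3/2 ^ℚ n) ≡ ℕ→ℚ (3 ℕ.^ n)
2^n*[3/2]^n≡3^n zero    = refl
2^n*[3/2]^n≡3^n (suc n) = begin
  ℕ→ℚ (2 ℕ.^ suc n) * (3/2 * (3/2 ^ℚ n))      ≡⟨ cong (_* (3/2 * (3/2 ^ℚ n))) (ℕ→ℚ-2^suc n) ⟩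
  two * ℕ→ℚ (2 ℕ.^ n) * (3/2 * (3/2 ^ℚ n))    ≡⟨ regroup (ℕ→ℚ (2 ℕ.^ n)) (3/2 ^ℚ n) ⟩
  ℕ→ℚ 3 * (ℕ→ℚ (2 ℕ.^ n) * (3/2 ^ℚ n))        ≡⟨ cong (ℕ→ℚ 3 *_) (2^n*[3/2]^n≡3^n n) ⟩
  ℕ→ℚ 3 * ℕ→ℚ (3 ℕ.^ n)                       ≡⟨ ℕ→ℚ-* 3 (3 ℕ.^ n) ⟨
  ℕ→ℚ (3 ℕ.^ suc n)                           ∎
  where
  open ≡-Reasoning
  regroup : ∀ x t → two * x * (3/2 * t) ≡ ℕ→ℚ 3 * (x * t)
  regroup = RingSolver.solve-∀ ℚ-ring

-- The bound as a term over any carrier, so that one expression serves both as a rational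
-- (bound-closed) and as a polynomial of the ring solver.
module ClosedForm {A : Set} (plus times minus : A → A → A) (κ : ℚ → A) where
  infixl 6 _⊞_ _⊟_
  infixl 7 _⊠_
  _⊞_ _⊠_ _⊟_ : A → A → A
  _⊞_ = plus
  _⊠_ = times
  _⊟_ = minus

  closedForm : (N X Y K M T : A) → A
  closedForm N X Y K M T =
    N ⊠ κ (+ 1 / 4) ⊠ (square (K ⊟ M ⊠ κ (+ 1 / 2) ⊟ κ (+ 7 / 4)) ⊞ κ (+ 9 / 2) ⊠ K ⊞ κ (+ 79 / 16))
      ⊞ X ⊠ T ⊠ (K ⊠ κ (+ 1 / 2) ⊟ M ⊠ κ (+ 1 / 6)) ⊟ X ⊠ (K ⊞ κ 1ℚ) ⊟ Y ⊠ T
    where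
    square : A → A
    square x = x ⊠ (x ⊠ κ 1ℚ)

  -- With X = 2^k, Y = 2^j, K = k, K₁ = k + 1 and n = k + 1 + j: the right-hand side of the
  -- recurrence at (n, k), and the bound at (n + 1, k + 1).
  closedRecurrence : (X Y K K₁ M₁ T₁ M₂ T₂ : A) → A
  closedRecurrence X Y K K₁ M₁ T₁ M₂ T₂ =
    closedForm N (κ two ⊠ X) Y K₁ M₁ T₁ ⊞ closedForm N X (κ two ⊠ Y) K M₂ T₂ ⊞ N ⊞ K₁ ⊠ X
    where N = X ⊠ (κ two ⊠ Y)

  closedNext : (X Y K₁ M T : A) → A
  closedNext X Y K₁ M T = closedForm (κ two ⊠ (X ⊠ (κ two ⊠ Y))) (κ two ⊠ X) (κ two ⊠ Y) K₁ M T

open ClosedForm _+_ _*_ _-_ (λ q → q) using (closedForm; closedRecurrence; closedNext)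
open module ClosedPolynomial {n : ℕ} = ClosedForm {Polynomial n} _:+_ _:*_ _:-_ con
  using ()
  renaming (closedForm to :closedForm; closedRecurrence to :closedRecurrence; closedNext to :closedNext)

bound-closed : ∀ n k {m N X Y K} → ℕ→ℚ (2 ℕ.^ n) ≡ N → ℕ→ℚ (2 ℕ.^ k) ≡ X → ℕ→ℚ (2 ℕ.^ (n ∸ k)) ≡ Y →
               ℕ→ℚ k ≡ K → k ⊓ (n ∸ k) ≡ m → bound n k ≡ closedForm N X Y K (ℕ→ℚ m) (3/2 ^ℚ m)
bound-closed n k refl refl refl refl refl = refl

Superrecurrent : ℕ → ℕ → Set
Superrecurrent n k =
  bound n (suc k) + bound n k + ℕ→ℚ (2 ℕ.^ n) + ℕ→ℚ (suc k ℕ.* 2 ℕ.^ k) ℚ.≤ bound (suc n) (suc k)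

superrecurrent-closed : ∀ k j {m₁ m₂ m₃} → suc k ⊓ j ≡ m₁ → k ⊓ suc j ≡ m₂ → suc k ⊓ suc j ≡ m₃ →
  let X = ℕ→ℚ (2 ℕ.^ k); Y = ℕ→ℚ (2 ℕ.^ j); K₁ = ℕ→ℚ (suc k) in
  closedRecurrence X Y (ℕ→ℚ k) K₁ (ℕ→ℚ m₁) (3/2 ^ℚ m₁) (ℕ→ℚ m₂) (3/2 ^ℚ m₂)
    ℚ.≤ closedNext X Y K₁ (ℕ→ℚ m₃) (3/2 ^ℚ m₃) →
  Superrecurrent (k ℕ.+ suc j) k
superrecurrent-closed k j {m₁} {m₂} {m₃} m₁≡ m₂≡ m₃≡ step = begin
  bound n (suc k) + bound n k + ℕ→ℚ (2 ℕ.^ n) + ℕ→ℚ (suc k ℕ.* 2 ℕ.^ k)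
    ≡⟨ cong₂ _+_ (cong₂ _+_ (cong₂ _+_ bound₁ bound₂) 2^n≡N) (ℕ→ℚ-* (suc k) (2 ℕ.^ k)) ⟩
  closedRecurrence X Y (ℕ→ℚ k) (ℕ→ℚ (suc k)) (ℕ→ℚ m₁) (3/2 ^ℚ m₁) (ℕ→ℚ m₂) (3/2 ^ℚ m₂)
    ≤⟨ step ⟩
  closedNext X Y (ℕ→ℚ (suc k)) (ℕ→ℚ m₃) (3/2 ^ℚ m₃)
    ≡⟨ bound₃ ⟨
  bound (suc n) (suc k) ∎
  where
  open ℚₚ.≤-Reasoning
  n = k ℕ.+ suc j
  X = ℕ→ℚ (2 ℕ.^ k)
  Y = ℕ→ℚ (2 ℕ.^ j)
  n∸k≡1+j : n ∸ k ≡ suc j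
  n∸k≡1+j = ℕₚ.m+n∸m≡n k (suc j)
  n∸[1+k]≡j : n ∸ suc k ≡ j
  n∸[1+k]≡j = trans (cong (_∸ suc k) (ℕₚ.+-suc k j)) (ℕₚ.m+n∸m≡n (suc k) j)
  2^[n∸k]≡2Y : ℕ→ℚ (2 ℕ.^ (n ∸ k)) ≡ two * Y
  2^[n∸k]≡2Y = trans (cong (λ e → ℕ→ℚ (2 ℕ.^ e)) n∸k≡1+j) (ℕ→ℚ-2^suc j)
  2^n≡N : ℕ→ℚ (2 ℕ.^ n) ≡ X * (two * Y)
  2^n≡N = trans (ℕ→ℚ-2^+ k (suc j)) (cong (X *_) (ℕ→ℚ-2^suc j))
  bound₁ : bound n (suc k) ≡ closedForm (X * (two * Y)) (two * X) Y (ℕ→ℚ (suc k)) (ℕ→ℚ m₁) (3/2 ^ℚ m₁)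
  bound₁ = bound-closed n (suc k) 2^n≡N (ℕ→ℚ-2^suc k) (cong (λ e → ℕ→ℚ (2 ℕ.^ e)) n∸[1+k]≡j) refl
             (trans (cong (suc k ⊓_) n∸[1+k]≡j) m₁≡)
  bound₂ : bound n k ≡ closedForm (X * (two * Y)) X (two * Y) (ℕ→ℚ k) (ℕ→ℚ m₂) (3/2 ^ℚ m₂)
  bound₂ = bound-closed n k 2^n≡N refl 2^[n∸k]≡2Y refl (trans (cong (k ⊓_) n∸k≡1+j) m₂≡)
  bound₃ : bound (suc n) (suc k) ≡ closedNext X Y (ℕ→ℚ (suc k)) (ℕ→ℚ m₃) (3/2 ^ℚ m₃)
  bound₃ = bound-closed (suc n) (suc k) (trans (ℕ→ℚ-2^suc n) (cong (two *_) 2^n≡N)) (ℕ→ℚ-2^suc k)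
             2^[n∸k]≡2Y refl (trans (cong (suc k ⊓_) n∸k≡1+j) m₃≡)

recurrence-k<j : ∀ K X Q T {K₁ Y S} → K₁ ≡ 1ℚ + K → Y ≡ two * (X * Q) → S ≡ X * T →
  ℕ→ℚ 4 * K * S + ℕ→ℚ 12 * (X * X) * Q ℚ.≤ ℕ→ℚ 6 * (X * X) * Q * K + ℕ→ℚ 12 * S * Q →
  closedRecurrence X Y K K₁ K₁ (3/2 * T) K T ℚ.≤ closedNext X Y K₁ K₁ (3/2 * T)
recurrence-k<j K X Q T refl refl refl slack = ≤-by-gap {c = + 1 / 12} slack (solve 4
  (λ K X Q T → let K₁ = con 1ℚ :+ K; Y = con two :* (X :* Q); S = X :* T in
    :closedNext X Y K₁ K₁ (con 3/2 :* T)
      :+ con (+ 1 / 12) :* (con (ℕ→ℚ 4) :* K :* S :+ con (ℕ→ℚ 12) :* (X :* X) :* Q)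
    := :closedRecurrence X Y K K₁ K₁ (con 3/2 :* T) K T
      :+ con (+ 1 / 12) :* (con (ℕ→ℚ 6) :* (X :* X) :* Q :* K :+ con (ℕ→ℚ 12) :* S :* Q))
  refl K X Q T)

recurrence-k≡j : ∀ K X T {K₁} → K₁ ≡ 1ℚ + K →
  closedRecurrence X X K K₁ K T K T ≡ closedNext X X K₁ K₁ (3/2 * T)
recurrence-k≡j K X T refl = solve 3
  (λ K X T → let K₁ = con 1ℚ :+ K in
    :closedRecurrence X X K K₁ K T K T := :closedNext X X K₁ K₁ (con 3/2 :* T))
  refl K X T

recurrence-j<k : ∀ J D Y Q T {J₁ K K₁ X S} → J₁ ≡ 1ℚ + J → K ≡ 1ℚ + (J + D) → K₁ ≡ 1ℚ + K →
  X ≡ two * (Y * Q) → S ≡ Y * T →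
  ℕ→ℚ 36 * (Y * Y) * Q + S * Q * (ℕ→ℚ 12 * J + ℕ→ℚ 18 * D)
    ℚ.≤ ℕ→ℚ 18 * (Y * Y) * Q * (J + two * D) + ℕ→ℚ 36 * S →
  closedRecurrence X Y K K₁ J T J₁ (3/2 * T) ℚ.≤ closedNext X Y K₁ J₁ (3/2 * T)
recurrence-j<k J D Y Q T refl refl refl refl refl slack = ≤-by-gap {c = + 1 / 36} slack (solve 5
  (λ J D Y Q T → let J₁ = con 1ℚ :+ J; K = con 1ℚ :+ (J :+ D); K₁ = con 1ℚ :+ K
                     X  = con two :* (Y :* Q); S = Y :* T in
    :closedNext X Y K₁ J₁ (con 3/2 :* T)
      :+ con (+ 1 / 36)
         :* (con (ℕ→ℚ 36) :* (Y :* Y) :* Q :+ S :* Q :* (con (ℕ→ℚ 12) :* J :+ con (ℕ→ℚ 18) :* D))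
    := :closedRecurrence X Y K K₁ J T J₁ (con 3/2 :* T)
      :+ con (+ 1 / 36) :* (con (ℕ→ℚ 18) :* (Y :* Y) :* Q :* (J :+ con two :* D) :+ con (ℕ→ℚ 36) :* S))
  refl J D Y Q T)

slack-k<j-ℚ : ∀ k d → let K = ℕ→ℚ k; S = ℕ→ℚ (3 ℕ.^ k); X = ℕ→ℚ (2 ℕ.^ k); Q = ℕ→ℚ (2 ℕ.^ d) in
  ℕ→ℚ 4 * K * S + ℕ→ℚ 12 * (X * X) * Q ℚ.≤ ℕ→ℚ 6 * (X * X) * Q * K + ℕ→ℚ 12 * S * Q
slack-k<j-ℚ k d = ⟦⟧-mono-≤ (lit 4 ⊗ lit k ⊗ s ⊕ lit 12 ⊗ (x ⊗ x) ⊗ q)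
                            (lit 6 ⊗ (x ⊗ x) ⊗ q ⊗ lit k ⊕ lit 12 ⊗ s ⊗ q)
                            (slack-k<j k (ℕₚ.m^n>0 2 d))
  where
  s = lit (3 ℕ.^ k)
  x = lit (2 ℕ.^ k)
  q = lit (2 ℕ.^ d)

slack-j<k-ℚ : ∀ j d → let J = ℕ→ℚ j; D = ℕ→ℚ d; S = ℕ→ℚ (3 ℕ.^ j); Y = ℕ→ℚ (2 ℕ.^ j); Q = ℕ→ℚ (2 ℕ.^ d) in
  ℕ→ℚ 36 * (Y * Y) * Q + S * Q * (ℕ→ℚ 12 * J + ℕ→ℚ 18 * D)
    ℚ.≤ ℕ→ℚ 18 * (Y * Y) * Q * (J + two * D) + ℕ→ℚ 36 * S
slack-j<k-ℚ j d = ⟦⟧-mono-≤ (lit 36 ⊗ (y ⊗ y) ⊗ q ⊕ s ⊗ q ⊗ (lit 12 ⊗ lit j ⊕ lit 18 ⊗ lit d))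
                            (lit 18 ⊗ (y ⊗ y) ⊗ q ⊗ (lit j ⊕ lit 2 ⊗ lit d) ⊕ lit 36 ⊗ s)
                            (slack-j<k j d)
  where
  s = lit (3 ℕ.^ j)
  y = lit (2 ℕ.^ j)
  q = lit (2 ℕ.^ d)

superrecurrent-split : ∀ k j → Superrecurrent (k ℕ.+ suc j) k
superrecurrent-split k j with ℕ.compare k j
... | ℕ.less .k d = superrecurrent-closed k j
  (ℕₚ.m≤n⇒m⊓n≡m (s≤s k≤k+d))
  (ℕₚ.m≤n⇒m⊓n≡m (ℕₚ.m≤n⇒m≤1+n (ℕₚ.m≤n⇒m≤1+n k≤k+d)))
  (ℕₚ.m≤n⇒m⊓n≡m (s≤s (ℕₚ.m≤n⇒m≤1+n k≤k+d)))
  (recurrence-k<j (ℕ→ℚ k) (ℕ→ℚ (2 ℕ.^ k)) (ℕ→ℚ (2 ℕ.^ d)) (3/2 ^ℚ k)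
    (ℕ→ℚ-suc k)
    (trans (ℕ→ℚ-2^suc (k ℕ.+ d)) (cong (two *_) (ℕ→ℚ-2^+ k d)))
    (sym (2^n*[3/2]^n≡3^n k))
    (slack-k<j-ℚ k d))
  where k≤k+d = ℕₚ.m≤m+n k d
... | ℕ.equal .k = superrecurrent-closed k k
  (ℕₚ.m≥n⇒m⊓n≡n (ℕₚ.n≤1+n k))
  (ℕₚ.m≤n⇒m⊓n≡m (ℕₚ.n≤1+n k))
  (ℕₚ.⊓-idem (suc k))
  (ℚₚ.≤-reflexive (recurrence-k≡j (ℕ→ℚ k) (ℕ→ℚ (2 ℕ.^ k)) (3/2 ^ℚ k) (ℕ→ℚ-suc k)))
... | ℕ.greater .j d = superrecurrent-closed (suc (j ℕ.+ d)) j
  (ℕₚ.m≥n⇒m⊓n≡n (ℕₚ.m≤n⇒m≤1+n (ℕₚ.m≤n⇒m≤1+n j≤j+d)))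
  (ℕₚ.m≥n⇒m⊓n≡n (s≤s j≤j+d))
  (ℕₚ.m≥n⇒m⊓n≡n (s≤s (ℕₚ.m≤n⇒m≤1+n j≤j+d)))
  (recurrence-j<k (ℕ→ℚ j) (ℕ→ℚ d) (ℕ→ℚ (2 ℕ.^ j)) (ℕ→ℚ (2 ℕ.^ d)) (3/2 ^ℚ j)
    (ℕ→ℚ-suc j)
    (trans (ℕ→ℚ-suc (j ℕ.+ d)) (cong (λ x → 1ℚ + x) (ℕ→ℚ-+ j d)))
    (ℕ→ℚ-suc (suc (j ℕ.+ d)))
    (trans (ℕ→ℚ-2^suc (j ℕ.+ d)) (cong (two *_) (ℕ→ℚ-2^+ j d)))
    (sym (2^n*[3/2]^n≡3^n j))
    (slack-j<k-ℚ j d))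
  where j≤j+d = ℕₚ.m≤m+n j d

superrecurrent : ∀ {n k} → k < n → Superrecurrent n k
superrecurrent {n} {k} k<n = subst (λ n → Superrecurrent n k) n≡k+[1+j] (superrecurrent-split k (n ∸ suc k))
  where
  n≡k+[1+j] : k ℕ.+ suc (n ∸ suc k) ≡ n
  n≡k+[1+j] = trans (ℕₚ.+-suc k (n ∸ suc k)) (ℕₚ.m+[n∸m]≡n k<n)

bound-zero : ∀ n → bound n 0 ≡ ℕ→ℚ (2 ℕ.^ n) - 1ℚ
bound-zero n =
  solve 1 (λ N → :closedForm N (con (ℕ→ℚ 1)) N (con (ℕ→ℚ 0)) (con (ℕ→ℚ 0)) (con 1ℚ) := N :- con 1ℚ)
    refl (ℕ→ℚ (2 ℕ.^ n))

bound-diagonal : ∀ n → bound n n ≡ ℕ→ℚ (2 ℕ.^ n ℕ.* (n ℕ.* n ∸ n ℕ.+ 4)) * (+ 1 / 4) - 1ℚ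
bound-diagonal n = begin
  bound n n
    ≡⟨ bound-closed n n refl refl (cong (λ e → ℕ→ℚ (2 ℕ.^ e)) (ℕₚ.n∸n≡0 n)) refl
         (trans (cong (n ⊓_) (ℕₚ.n∸n≡0 n)) (ℕₚ.⊓-zeroʳ n)) ⟩
  closedForm N N (ℕ→ℚ 1) K (ℕ→ℚ 0) 1ℚ
    ≡⟨ solve 2 (λ N K → :closedForm N N (con (ℕ→ℚ 1)) K (con (ℕ→ℚ 0)) (con 1ℚ)
                      := N :* (K :* K :- K :+ con (ℕ→ℚ 4)) :* con (+ 1 / 4) :- con 1ℚ) refl N K ⟩
  N * (K * K - K + ℕ→ℚ 4) * (+ 1 / 4) - 1ℚ
    ≡⟨ cong (λ x → x * (+ 1 / 4) - 1ℚ) 2^n[n²-n+4]≡N[K²-K+4] ⟨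
  ℕ→ℚ (2 ℕ.^ n ℕ.* (n ℕ.* n ∸ n ℕ.+ 4)) * (+ 1 / 4) - 1ℚ ∎
  where
  open ≡-Reasoning
  N = ℕ→ℚ (2 ℕ.^ n)
  K = ℕ→ℚ n
  n≤n*n : ∀ n → n ≤ n ℕ.* n
  n≤n*n zero    = z≤n
  n≤n*n (suc n) = ℕₚ.m≤m*n (suc n) (suc n)
  2^n[n²-n+4]≡N[K²-K+4] : ℕ→ℚ (2 ℕ.^ n ℕ.* (n ℕ.* n ∸ n ℕ.+ 4)) ≡ N * (K * K - K + ℕ→ℚ 4)
  2^n[n²-n+4]≡N[K²-K+4] = trans (ℕ→ℚ-* (2 ℕ.^ n) _) (cong (N *_) (trans (ℕ→ℚ-+ (n ℕ.* n ∸ n) 4)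
                   (cong (_+ ℕ→ℚ 4) (trans (ℕ→ℚ-∸ (n≤n*n n)) (cong (_- K) (ℕ→ℚ-* n n))))))

4p+4≤a⇒p≤a/4-1 : ∀ {p a} → 4 ℕ.* p ℕ.+ 4 ≤ a → ℕ→ℚ p ℚ.≤ ℕ→ℚ a * (+ 1 / 4) - 1ℚ
4p+4≤a⇒p≤a/4-1 {p} {a} 4p+4≤a =
  ≤-by-gap {c = + 1 / 4} (⟦⟧-mono-≤ (lit 4 ⊗ lit p ⊕ lit 4) (lit a) 4p+4≤a) (gap (ℕ→ℚ p) (ℕ→ℚ a))
  where
  gap : ∀ x y → y * (+ 1 / 4) - 1ℚ + + 1 / 4 * (ℕ→ℚ 4 * x + ℕ→ℚ 4) ≡ x + + 1 / 4 * y
  gap = RingSolver.solve-∀ ℚ-ring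

Obatcher≤bound : ∀ n → ℕ→ℚ (Obatcher n) ℚ.≤ bound n n
Obatcher≤bound n =
  ℚₚ.≤-trans (4p+4≤a⇒p≤a/4-1 {Obatcher n} (4*[a/4∸1]+4≤a 4≤a)) (ℚₚ.≤-reflexive (sym (bound-diagonal n)))
  where
  4≤a : 4 ≤ 2 ℕ.^ n ℕ.* (n ℕ.* n ∸ n ℕ.+ 4)
  4≤a = ℕₚ.*-mono-≤ (ℕₚ.m^n>0 2 n) (ℕₚ.m≤n+m 4 (n ℕ.* n ∸ n))

P-recurrenceℚ : ∀ {n k} → k < n →
  ℕ→ℚ (P (suc n) (suc k)) ≡ ℕ→ℚ (P n (suc k)) + ℕ→ℚ (P n k) + ℕ→ℚ (2 ℕ.^ n) + ℕ→ℚ (suc k ℕ.* 2 ℕ.^ k)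
P-recurrenceℚ {n} {k} k<n = trans (cong ℕ→ℚ (P-recurrence k<n))
  (ℕ→ℚ-⟦⟧ (lit (P n (suc k)) ⊕ lit (P n k) ⊕ lit (2 ℕ.^ n) ⊕ lit (suc k ℕ.* 2 ℕ.^ k)))

theorem4 : (n k : ℕ) → k ≤ n → ℕ→ℚ (P n k) ≤ℚ bound n k
theorem4 n zero _ = ℚₚ.≤-reflexive (trans (ℕ→ℚ-∸ (ℕₚ.m^n>0 2 n)) (sym (bound-zero n)))
theorem4 (suc n) (suc k) (s≤s k≤n) with ℕₚ.m≤n⇒m<n∨m≡n k≤n
... | inj₂ refl = subst (λ p → ℕ→ℚ p ≤ℚ bound (suc n) (suc n)) (sym (P-diagonal n)) (Obatcher≤bound (suc n))
... | inj₁ k<n = begin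
  ℕ→ℚ (P (suc n) (suc k))
    ≡⟨ P-recurrenceℚ k<n ⟩
  ℕ→ℚ (P n (suc k)) + ℕ→ℚ (P n k) + ℕ→ℚ (2 ℕ.^ n) + ℕ→ℚ (suc k ℕ.* 2 ℕ.^ k)
    ≤⟨ ℚₚ.+-monoˡ-≤ (ℕ→ℚ (suc k ℕ.* 2 ℕ.^ k)) (ℚₚ.+-monoˡ-≤ (ℕ→ℚ (2 ℕ.^ n))
         (ℚₚ.+-mono-≤ (theorem4 n (suc k) k<n) (theorem4 n k (ℕₚ.<⇒≤ k<n)))) ⟩
  bound n (suc k) + bound n k + ℕ→ℚ (2 ℕ.^ n) + ℕ→ℚ (suc k ℕ.* 2 ℕ.^ k)
    ≤⟨ superrecurrent k<n ⟩
  bound (suc n) (suc k) ∎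
  where open ℚₚ.≤-Reasoning
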